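{- Let $N\in\{1,2,3\}$, $D=D^{(N)}$, and let $\widetilde D=\widetilde{D^{(N)}}$ be the derivation $\widetilde Df=p_xf_x+q_xf_y+r_xf_z$ (equivalently $\widetilde Df=\frac1d(2xf_x+4yf_y+6zf_z)$). Then (a) $\frac{\partial}{\partial x}(Df)=\widetilde Df+D(f_x)$ for all $f\in\mathbb{Q}[x,y,z,1/y]$; (b) $\widetilde D D^n=D^n\widetilde D+\frac{2n}{d}D^n$ for all integers $n\ge1$.
   Context: $D^{(N)}f=pf_x+qf_y+rf_z$ (subscripts denote partial derivatives), where for $N=1$: $p=\frac{x^2-y}{12}$, $q=\frac{xy-z}{3}$, $r=\frac{xz-y^2}{2}$; for $N=2$: $p=\frac{x^2-y}{8}$, $q=\frac{xy-z}{2}$, $r=\frac{3xz-2y^2-z^2/y}{4}$; for $N=3$: $p=\frac{x^2-y}{6}$, $q=\frac{2(xy-z)}{3}$, $r=\frac{2xz-y^2-z^2/y}{2}$. $d=12,8,6$ for $N=1,2,3$ respectively. $p_x,q_x,r_x$ are partial derivatives in $x$. -}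

module Defs where

open import Data.Nat as ℕ using (ℕ; zero; suc; NonZero)
open import Data.Integer as ℤ using (ℤ; +_; -[1+_])
open import Data.Rational as ℚ using (ℚ; 0ℚ; _/_)
open import Data.List using (List; []; _∷_; map; concatMap; _++_)
open import Data.Bool using (if_then_else_; _∧_)
open import Relation.Nullary using (does)
open import Relation.Binary.PropositionalEquality using (_≡_)
open import Function using (_∘_)

-- Elements of ℚ[x, y, z, 1/y] as finite formal sums of monomials
-- c · x^a · y^b · z^c  (a c : ℕ, b : ℤ).  Two representations are equal
-- as elements of the ring iff all their coefficients agree (_≈_).

record Mono : Set where
  constructor mono
  field
    co : ℚ
    ex : ℕ
    ey : ℤ
    ez : ℕ
open Mono public

Poly : Set
Poly = List Mono

coeff : Poly → ℕ → ℤ → ℕ → ℚ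
coeff [] a b c = 0ℚ
coeff (m ∷ f) a b c =
  (if does (ex m ℕ.≟ a) ∧ does (ey m ℤ.≟ b) ∧ does (ez m ℕ.≟ c)
     then co m else 0ℚ) ℚ.+ coeff f a b c

infix 4 _≈_
_≈_ : Poly → Poly → Set
f ≈ g = ∀ a b c → coeff f a b c ≡ coeff g a b c

infixl 6 _⊕_
infixl 7 _⊗_ _·_
_⊕_ : Poly → Poly → Poly
f ⊕ g = f ++ g

_·_ : ℚ → Poly → Poly
q · f = map (λ m → mono (q ℚ.* co m) (ex m) (ey m) (ez m)) f

monoMul : Mono → Mono → Mono
monoMul m n = mono (co m ℚ.* co n) (ex m ℕ.+ ex n) (ey m ℤ.+ ey n) (ez m ℕ.+ ez n)

_⊗_ : Poly → Poly → Poly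
f ⊗ g = concatMap (λ m → map (monoMul m) g) f

ℕtoℚ : ℕ → ℚ
ℕtoℚ n = + n / 1

ℤtoℚ : ℤ → ℚ
ℤtoℚ k = k / 1

∂x ∂y ∂z : Poly → Poly
∂x = map (λ m → mono (ℕtoℚ (ex m) ℚ.* co m) (ex m ℕ.∸ 1) (ey m) (ez m))
∂y = map (λ m → mono (ℤtoℚ (ey m) ℚ.* co m) (ex m) (ey m ℤ.- + 1) (ez m))
∂z = map (λ m → mono (ℕtoℚ (ez m) ℚ.* co m) (ex m) (ey m) (ez m ℕ.∸ 1))

-- The coefficients p, q, r of D^(N) (N ∈ {1,2,3}; other N: zero, unused)

pP qP rP : ℕ → Poly
pP 1 = mono (+ 1 / 12) 2 (+ 0) 0 ∷ mono (ℚ.- (+ 1 / 12)) 0 (+ 1) 0 ∷ []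
pP 2 = mono (+ 1 / 8) 2 (+ 0) 0 ∷ mono (ℚ.- (+ 1 / 8)) 0 (+ 1) 0 ∷ []
pP 3 = mono (+ 1 / 6) 2 (+ 0) 0 ∷ mono (ℚ.- (+ 1 / 6)) 0 (+ 1) 0 ∷ []
pP _ = []

qP 1 = mono (+ 1 / 3) 1 (+ 1) 0 ∷ mono (ℚ.- (+ 1 / 3)) 0 (+ 0) 1 ∷ []
qP 2 = mono (+ 1 / 2) 1 (+ 1) 0 ∷ mono (ℚ.- (+ 1 / 2)) 0 (+ 0) 1 ∷ []
qP 3 = mono (+ 2 / 3) 1 (+ 1) 0 ∷ mono (ℚ.- (+ 2 / 3)) 0 (+ 0) 1 ∷ []
qP _ = []

rP 1 = mono (+ 1 / 2) 1 (+ 0) 1 ∷ mono (ℚ.- (+ 1 / 2)) 0 (+ 2) 0 ∷ []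
rP 2 = mono (+ 3 / 4) 1 (+ 0) 1 ∷ mono (ℚ.- (+ 2 / 4)) 0 (+ 2) 0
     ∷ mono (ℚ.- (+ 1 / 4)) 0 (-[1+ 0 ]) 2 ∷ []
rP 3 = mono (+ 2 / 2) 1 (+ 0) 1 ∷ mono (ℚ.- (+ 1 / 2)) 0 (+ 2) 0
     ∷ mono (ℚ.- (+ 1 / 2)) 0 (-[1+ 0 ]) 2 ∷ []
rP _ = []

d : ℕ → ℕ
d 1 = 12
d 2 = 8
d 3 = 6
d _ = 1

instance
  d-nonZero : ∀ {N} → NonZero (d N)
  d-nonZero {0} = _
  d-nonZero {1} = _
  d-nonZero {2} = _
  d-nonZero {3} = _
  d-nonZero {suc (suc (suc (suc _)))} = _

D : ℕ → Poly → Poly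
D N f = pP N ⊗ ∂x f ⊕ qP N ⊗ ∂y f ⊕ rP N ⊗ ∂z f

D̃ : ℕ → Poly → Poly
D̃ N f = ∂x (pP N) ⊗ ∂x f ⊕ ∂x (qP N) ⊗ ∂y f ⊕ ∂x (rP N) ⊗ ∂z f

iter : ℕ → (Poly → Poly) → Poly → Poly
iter zero    T f = f
iter (suc n) T f = T (iter n T f)

module Submission where

-- Work on coefficient functions ℕ → ℤ → ℕ → ℚ, where D, D̃ and ∂x become linear operators.
-- Part (a) is the Leibniz rule for ∂x applied to p f_x + q f_y + r f_z, together with the
-- commutation of ∂x with ∂y and ∂z. For part (b), give x, y, z the weights 2, 4, 6 and let E
-- multiply the coefficient of x^a y^b z^c by 2a + 4b + 6c. Since p, q, r are homogeneous of
-- weights 4, 6, 8, the derivation D raises weight by 2, i.e. E D = D E + 2 D, so by induction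
-- E Dⁿ = Dⁿ E + 2n Dⁿ. Finally p_x, q_x, r_x are 2x/d, 4y/d, 6z/d, so D̃ = E/d, and dividing
-- by d gives (b).

open import Defs
open import Data.Bool using (Bool; true; false; if_then_else_; _∧_)
open import Data.Bool.Properties using (∧-zeroʳ; if-eta)
open import Data.Integer as ℤ using (ℤ; +_)
import Data.Integer.Properties as ℤP
import Data.Integer.Tactic.RingSolver as ℤ-Solver
open import Data.List using ([]; _∷_; map; _++_; drop)
open import Data.List.Relation.Unary.All using (All; []; _∷_)
open import Data.Nat as ℕ using (ℕ; zero; suc)
import Data.Nat.Properties as ℕP
open import Data.Product using (_×_; _,_)
open import Data.Rational as ℚ using (ℚ; 0ℚ; 1ℚ; _+_; _*_; -_; _-_; _/_)
import Data.Rational.Properties as ℚP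
open import Data.Rational.Unnormalised as ℚᵘ using (mkℚᵘ)
import Data.Rational.Unnormalised.Properties as ℚᵘP
open import Data.Sum using (_⊎_; inj₁; inj₂)
open import Function using (_⇔_; mk⇔)
open import Relation.Binary.PropositionalEquality
open import Relation.Nullary using (Dec; does; yes; no)
open import Relation.Nullary.Decidable using (does-⇔; dec⇒maybe)
open import Tactic.RingSolver using (solve-∀)
open import Tactic.RingSolver.Core.AlmostCommutativeRing using (AlmostCommutativeRing; fromCommutativeRing)

fromℚᵘ-+ : ∀ p q → ℚ.fromℚᵘ p + ℚ.fromℚᵘ q ≡ ℚ.fromℚᵘ (p ℚᵘ.+ q)
fromℚᵘ-+ p q = trans (sym (ℚP.fromℚᵘ-toℚᵘ _)) (ℚP.fromℚᵘ-cong
  (ℚᵘP.≃-trans (ℚP.toℚᵘ-homo-+ (ℚ.fromℚᵘ p) (ℚ.fromℚᵘ q))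
               (ℚᵘP.+-cong (ℚP.toℚᵘ-fromℚᵘ p) (ℚP.toℚᵘ-fromℚᵘ q))))

fromℚᵘ-* : ∀ p q → ℚ.fromℚᵘ p * ℚ.fromℚᵘ q ≡ ℚ.fromℚᵘ (p ℚᵘ.* q)
fromℚᵘ-* p q = trans (sym (ℚP.fromℚᵘ-toℚᵘ _)) (ℚP.fromℚᵘ-cong
  (ℚᵘP.≃-trans (ℚP.toℚᵘ-homo-* (ℚ.fromℚᵘ p) (ℚ.fromℚᵘ q))
               (ℚᵘP.*-cong (ℚP.toℚᵘ-fromℚᵘ p) (ℚP.toℚᵘ-fromℚᵘ q))))

ℤtoℚ-+ : ∀ i j → ℤtoℚ (i ℤ.+ j) ≡ ℤtoℚ i + ℤtoℚ j
ℤtoℚ-+ i j = sym (trans (fromℚᵘ-+ (mkℚᵘ i 0) (mkℚᵘ j 0))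
  (ℚP.fromℚᵘ-cong (ℚᵘ.*≡* {mkℚᵘ i 0 ℚᵘ.+ mkℚᵘ j 0} {mkℚᵘ (i ℤ.+ j) 0} (eq i j))))
  where
  eq : ∀ i j → (i ℤ.* + 1 ℤ.+ j ℤ.* + 1) ℤ.* + 1 ≡ (i ℤ.+ j) ℤ.* (+ 1 ℤ.* + 1)
  eq = ℤ-Solver.solve-∀

fromℚᵘ-*-ℤtoℚ : ∀ i k j →
  ℚ.fromℚᵘ (mkℚᵘ i k) * ℤtoℚ j ≡ ℚ.fromℚᵘ (mkℚᵘ (i ℤ.* j) k)
fromℚᵘ-*-ℤtoℚ i k j = trans (fromℚᵘ-* (mkℚᵘ i k) (mkℚᵘ j 0))
  (ℚP.fromℚᵘ-cong (ℚᵘ.*≡* {mkℚᵘ i k ℚᵘ.* mkℚᵘ j 0} {mkℚᵘ (i ℤ.* j) k}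
                           (eq i j (+ suc k))))
  where
  eq : ∀ i j K → (i ℤ.* j) ℤ.* K ≡ (i ℤ.* j) ℤ.* (K ℤ.* + 1)
  eq = ℤ-Solver.solve-∀

ℤtoℚ-* : ∀ i j → ℤtoℚ (i ℤ.* j) ≡ ℤtoℚ i * ℤtoℚ j
ℤtoℚ-* i j = sym (fromℚᵘ-*-ℤtoℚ i 0 j)

ℕtoℚ-suc : ∀ n → ℕtoℚ (suc n) ≡ 1ℚ + ℕtoℚ n
ℕtoℚ-suc n = ℤtoℚ-+ (+ 1) (+ n)

-- fromℚᵘ (mkℚᵘ i k) is i / suc k; it is written this way because instance search cannot
-- choose between ℕ.nonZero and Defs.d-nonZero for NonZero (suc k).
1/suc-*-n*2 : ∀ k n →
  ℚ.fromℚᵘ (mkℚᵘ (+ 1) k) * (ℕtoℚ n * ℕtoℚ 2) ≡ ℚ.fromℚᵘ (mkℚᵘ (+ (2 ℕ.* n)) k)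
1/suc-*-n*2 k n = begin
  ℚ.fromℚᵘ (mkℚᵘ (+ 1) k) * (ℕtoℚ n * ℕtoℚ 2)
    ≡⟨ cong (ℚ.fromℚᵘ (mkℚᵘ (+ 1) k) *_) (ℤtoℚ-* (+ n) (+ 2)) ⟨
  ℚ.fromℚᵘ (mkℚᵘ (+ 1) k) * ℤtoℚ (+ n ℤ.* + 2)
    ≡⟨ fromℚᵘ-*-ℤtoℚ (+ 1) k (+ n ℤ.* + 2) ⟩
  ℚ.fromℚᵘ (mkℚᵘ (+ 1 ℤ.* (+ n ℤ.* + 2)) k)
    ≡⟨ cong (λ i → ℚ.fromℚᵘ (mkℚᵘ i k)) numerator ⟩
  ℚ.fromℚᵘ (mkℚᵘ (+ (2 ℕ.* n)) k) ∎
  where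
  open ≡-Reasoning
  numerator : + 1 ℤ.* (+ n ℤ.* + 2) ≡ + (2 ℕ.* n)
  numerator = trans (ℤP.*-identityˡ _) (trans (sym (ℤP.pos-* n 2)) (cong +_ (ℕP.*-comm n 2)))

ℚ-ring : AlmostCommutativeRing _ _
ℚ-ring = fromCommutativeRing ℚP.+-*-commutativeRing (λ q → dec⇒maybe (0ℚ ℚP.≟ q))

-- An operator with superscript ᶜ is the action on coefficient functions of the Poly operation
-- of the same name (monoᶜ m and polyᶜ P: multiplication by m and by P).
Coeffs : Set
Coeffs = ℕ → ℤ → ℕ → ℚ

Op : Set
Op = Coeffs → Coeffs

infix 4 _≋_
_≋_ : Coeffs → Coeffs → Set
F ≋ G = ∀ a b c → F a b c ≡ G a b c

infixl 6 _⊞_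
infixl 7 _⊡_
_⊞_ : Coeffs → Coeffs → Coeffs
(F ⊞ G) a b c = F a b c + G a b c

_⊡_ : ℚ → Coeffs → Coeffs
(k ⊡ F) a b c = k * F a b c

𝟘 : Coeffs
𝟘 a b c = 0ℚ

record IsLinear (O : Op) : Set where
  field
    ext    : ∀ {F G} → F ≋ G → O F ≋ O G
    ⊞-homo : ∀ F G → O (F ⊞ G) ≋ O F ⊞ O G
    ⊡-homo : ∀ k F → O (k ⊡ F) ≋ k ⊡ O F
    𝟘-homo : O 𝟘 ≋ 𝟘
open IsLinear

*-distribˡ-+ : ∀ k x y → k * (x + y) ≡ k * x + k * y
*-distribˡ-+ = solve-∀ ℚ-ring

+-interchange : ∀ x y z w → (x + y) + (z + w) ≡ (x + z) + (y + w)
+-interchange = solve-∀ ℚ-ring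

*-left-comm : ∀ k l x → k * (l * x) ≡ l * (k * x)
*-left-comm = solve-∀ ℚ-ring

linear-∘ : ∀ {O O′} → IsLinear O → IsLinear O′ → IsLinear (λ F → O (O′ F))
linear-∘ L L′ = record
  { ext    = λ e → ext L (ext L′ e)
  ; ⊞-homo = λ F G a b c → trans (ext L (⊞-homo L′ F G) a b c) (⊞-homo L _ _ a b c)
  ; ⊡-homo = λ k F a b c → trans (ext L (⊡-homo L′ k F) a b c) (⊡-homo L k _ a b c)
  ; 𝟘-homo = λ a b c → trans (ext L (𝟘-homo L′) a b c) (𝟘-homo L a b c)
  }

linear-⊞ : ∀ {O O′} → IsLinear O → IsLinear O′ → IsLinear (λ F → O F ⊞ O′ F)
linear-⊞ {O} {O′} L L′ = record
  { ext    = λ e a b c → cong₂ _+_ (ext L e a b c) (ext L′ e a b c)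
  ; ⊞-homo = λ F G a b c → trans (cong₂ _+_ (⊞-homo L F G a b c) (⊞-homo L′ F G a b c))
                                 (+-interchange (O F a b c) (O G a b c) (O′ F a b c) (O′ G a b c))
  ; ⊡-homo = λ k F a b c → trans (cong₂ _+_ (⊡-homo L k F a b c) (⊡-homo L′ k F a b c))
                                 (sym (*-distribˡ-+ k _ _))
  ; 𝟘-homo = λ a b c → cong₂ _+_ (𝟘-homo L a b c) (𝟘-homo L′ a b c)
  }

linear-⊡ : ∀ k → IsLinear (k ⊡_)
linear-⊡ k = record
  { ext    = λ e a b c → cong (k *_) (e a b c)
  ; ⊞-homo = λ F G a b c → *-distribˡ-+ k _ _
  ; ⊡-homo = λ l F a b c → *-left-comm k l _
  ; 𝟘-homo = λ a b c → ℚP.*-zeroʳ k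
  }

linear-𝟘 : IsLinear (λ _ → 𝟘)
linear-𝟘 = record
  { ext    = λ _ a b c → refl
  ; ⊞-homo = λ _ _ a b c → refl
  ; ⊡-homo = λ k _ a b c → sym (ℚP.*-zeroʳ k)
  ; 𝟘-homo = λ a b c → refl
  }

linear-weighted : ∀ (w : Coeffs) (σx : ℕ → ℕ) (σy : ℤ → ℤ) (σz : ℕ → ℕ) →
  IsLinear (λ F a b c → w a b c * F (σx a) (σy b) (σz c))
linear-weighted w σx σy σz = record
  { ext    = λ e a b c → cong (w a b c *_) (e _ _ _)
  ; ⊞-homo = λ F G a b c → *-distribˡ-+ (w a b c) _ _
  ; ⊡-homo = λ k F a b c → *-left-comm (w a b c) k _
  ; 𝟘-homo = λ a b c → ℚP.*-zeroʳ (w a b c)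
  }

∂xᶜ ∂yᶜ ∂zᶜ : Op
∂xᶜ F a b c = ℕtoℚ (suc a) * F (suc a) b c
∂yᶜ F a b c = ℤtoℚ (b ℤ.+ + 1) * F a (b ℤ.+ + 1) c
∂zᶜ F a b c = ℕtoℚ (suc c) * F a b (suc c)

linear-∂xᶜ : IsLinear ∂xᶜ
linear-∂xᶜ = linear-weighted (λ a b c → ℕtoℚ (suc a)) suc (λ b → b) (λ c → c)

linear-∂yᶜ : IsLinear ∂yᶜ
linear-∂yᶜ = linear-weighted (λ a b c → ℤtoℚ (b ℤ.+ + 1)) (λ a → a) (ℤ._+ + 1) (λ c → c)

linear-∂zᶜ : IsLinear ∂zᶜ
linear-∂zᶜ = linear-weighted (λ a b c → ℕtoℚ (suc c)) (λ a → a) (λ b → b) suc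

-- Multiplication by t^i on the coefficient sequence of a series in t.
shift : ℕ → (ℕ → ℚ) → ℕ → ℚ
shift zero    g a       = g a
shift (suc i) g zero    = 0ℚ
shift (suc i) g (suc a) = shift i g a

shift-cong : ∀ i {g h} → (∀ a → g a ≡ h a) → ∀ a → shift i g a ≡ shift i h a
shift-cong zero    e a       = e a
shift-cong (suc i) e zero    = refl
shift-cong (suc i) e (suc a) = shift-cong i e a

shift-zipWith : ∀ (_∙_ : ℚ → ℚ → ℚ) → 0ℚ ∙ 0ℚ ≡ 0ℚ → ∀ i g h a →
  shift i (λ a → g a ∙ h a) a ≡ shift i g a ∙ shift i h a
shift-zipWith _∙_ 0∙0 zero    g h a       = refl
shift-zipWith _∙_ 0∙0 (suc i) g h zero    = sym 0∙0
shift-zipWith _∙_ 0∙0 (suc i) g h (suc a) = shift-zipWith _∙_ 0∙0 i g h a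

shiftX shiftZ : ℕ → Op
shiftX i F a b c = shift i (λ a → F a b c) a
shiftZ l F a b c = shift l (λ c → F a b c) c

shiftY : ℤ → Op
shiftY j F a b c = F a (b ℤ.- j) c

linear-shiftX : ∀ i → IsLinear (shiftX i)
linear-shiftX i = record
  { ext    = λ e a b c → shift-cong i (λ a → e a b c) a
  ; ⊞-homo = λ F G a b c → shift-zipWith _+_ refl i _ _ a
  ; ⊡-homo = λ k F a b c → shift-zipWith (λ u _ → k * u) (ℚP.*-zeroʳ k) i (λ a → F a b c) (λ _ → 0ℚ) a
  ; 𝟘-homo = λ a b c → shift-zipWith (λ _ _ → 0ℚ) refl i (λ _ → 0ℚ) (λ _ → 0ℚ) a
  }

linear-shiftZ : ∀ l → IsLinear (shiftZ l)
linear-shiftZ l = record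
  { ext    = λ e a b c → shift-cong l (λ c → e a b c) c
  ; ⊞-homo = λ F G a b c → shift-zipWith _+_ refl l _ _ c
  ; ⊡-homo = λ k F a b c → shift-zipWith (λ u _ → k * u) (ℚP.*-zeroʳ k) l (λ c → F a b c) (λ _ → 0ℚ) c
  ; 𝟘-homo = λ a b c → shift-zipWith (λ _ _ → 0ℚ) refl l (λ _ → 0ℚ) (λ _ → 0ℚ) c
  }

linear-shiftY : ∀ j → IsLinear (shiftY j)
linear-shiftY j = record
  { ext    = λ e a b c → e _ _ _
  ; ⊞-homo = λ F G a b c → refl
  ; ⊡-homo = λ k F a b c → refl
  ; 𝟘-homo = λ a b c → refl
  }

monoᶜ : Mono → Op
monoᶜ m F = co m ⊡ shiftX (ex m) (shiftZ (ez m) (shiftY (ey m) F))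

polyᶜ : Poly → Op
polyᶜ []      F = 𝟘
polyᶜ (m ∷ P) F = monoᶜ m F ⊞ polyᶜ P F

derᶜ : Poly → Poly → Poly → Op
derᶜ P Q R F = polyᶜ P (∂xᶜ F) ⊞ polyᶜ Q (∂yᶜ F) ⊞ polyᶜ R (∂zᶜ F)

linear-monoᶜ : ∀ m → IsLinear (monoᶜ m)
linear-monoᶜ m = linear-∘ (linear-⊡ (co m))
  (linear-∘ (linear-shiftX (ex m)) (linear-∘ (linear-shiftZ (ez m)) (linear-shiftY (ey m))))

linear-polyᶜ : ∀ P → IsLinear (polyᶜ P)
linear-polyᶜ []      = linear-𝟘
linear-polyᶜ (m ∷ P) = linear-⊞ (linear-monoᶜ m) (linear-polyᶜ P)

linear-derᶜ : ∀ P Q R → IsLinear (derᶜ P Q R)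
linear-derᶜ P Q R = linear-⊞ (linear-⊞ (linear-∘ (linear-polyᶜ P) linear-∂xᶜ)
  (linear-∘ (linear-polyᶜ Q) linear-∂yᶜ)) (linear-∘ (linear-polyᶜ R) linear-∂zᶜ)

matches : ℕ → ℤ → ℕ → ℕ → ℤ → ℕ → Bool
matches e j l a b c = does (e ℕ.≟ a) ∧ does (j ℤ.≟ b) ∧ does (l ℕ.≟ c)

monoCoeff : Mono → Coeffs
monoCoeff m a b c = if matches (ex m) (ey m) (ez m) a b c then co m else 0ℚ

∧-zeroʳ³ : ∀ x y → x ∧ y ∧ false ≡ false
∧-zeroʳ³ x y = trans (cong (x ∧_) (∧-zeroʳ y)) (∧-zeroʳ x)

does³⇒ : ∀ {A B C : Set} (A? : Dec A) (B? : Dec B) (C? : Dec C) →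
  does A? ∧ does B? ∧ does C? ≡ true → A × B × C
does³⇒ (yes p) (yes q) (yes r) _ = p , q , r
does³⇒ (yes _) (yes _) (no _)  ()
does³⇒ (yes _) (no _)  _       ()
does³⇒ (no _)  _       _       ()

matches⇒≡ : ∀ e j l a b c → matches e j l a b c ≡ true → e ≡ a × j ≡ b × l ≡ c
matches⇒≡ e j l a b c = does³⇒ (e ℕ.≟ a) (j ℤ.≟ b) (l ℕ.≟ c)

if-matches : ∀ e j l a b c (φ : ℕ → ℤ → ℕ → ℚ) →
  (if matches e j l a b c then φ e j l else 0ℚ) ≡ (if matches e j l a b c then φ a b c else 0ℚ)
if-matches e j l a b c φ with matches e j l a b c in eq
... | false = refl
... | true with refl , refl , refl ← matches⇒≡ e j l a b c eq = refl

matches-cong-y : ∀ e l a c {j j′ b b′} → (j ≡ b ⇔ j′ ≡ b′) →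
  matches e j l a b c ≡ matches e j′ l a b′ c
matches-cong-y e l a c {j} {j′} {b} {b′} j≡b⇔j′≡b′ =
  cong (λ t → does (e ℕ.≟ a) ∧ t ∧ does (l ℕ.≟ c)) (does-⇔ j≡b⇔j′≡b′ (j ℤ.≟ b) (j′ ℤ.≟ b′))

-≡⇔≡+ : ∀ x y k → (x ℤ.- k ≡ y) ⇔ (x ≡ y ℤ.+ k)
-≡⇔≡+ x y k = mk⇔ (λ p → trans (sym (-+-cancel x k)) (cong (ℤ._+ k) p))
                  (λ p → trans (cong (ℤ._- k) p) (+--cancel y k))
  where
  -+-cancel : ∀ x k → x ℤ.- k ℤ.+ k ≡ x
  -+-cancel = ℤ-Solver.solve-∀
  +--cancel : ∀ y k → y ℤ.+ k ℤ.- k ≡ y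
  +--cancel = ℤ-Solver.solve-∀

if-* : ∀ B k u → (if B then k * u else 0ℚ) ≡ k * (if B then u else 0ℚ)
if-* true  k u = refl
if-* false k u = sym (ℚP.*-zeroʳ k)

if-*-zeroˡ : ∀ B k u → (if B then ℕtoℚ 0 * u else 0ℚ) ≡ k * 0ℚ
if-*-zeroˡ B k u = trans (cong (λ t → if B then t else 0ℚ) (ℚP.*-zeroˡ u))
                    (trans (if-eta B) (sym (ℚP.*-zeroʳ k)))

coeff-++ : ∀ f g → coeff (f ++ g) ≋ coeff f ⊞ coeff g
coeff-++ []      g a b c = sym (ℚP.+-identityˡ _)
coeff-++ (m ∷ f) g a b c = trans (cong (λ t → monoCoeff m a b c + t) (coeff-++ f g a b c))
                                 (sym (ℚP.+-assoc (monoCoeff m a b c) _ _))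

coeff-map : ∀ (φ : Mono → Mono) {O} → IsLinear O → (∀ m → monoCoeff (φ m) ≋ O (monoCoeff m)) →
  ∀ f → coeff (map φ f) ≋ O (coeff f)
coeff-map φ L hφ []      a b c = sym (𝟘-homo L a b c)
coeff-map φ L hφ (m ∷ f) a b c =
  trans (cong₂ _+_ (hφ m a b c) (coeff-map φ L hφ f a b c)) (sym (⊞-homo L (monoCoeff m) (coeff f) a b c))

coeff-· : ∀ q f → coeff (q · f) ≋ q ⊡ coeff f
coeff-· q = coeff-map _ (linear-⊡ q) (λ m a b c → if-* _ q (co m))

coeff-∂x : ∀ f → coeff (∂x f) ≋ ∂xᶜ (coeff f)
coeff-∂x = coeff-map _ linear-∂xᶜ (λ m → mono-∂x (co m) (ex m) (ey m) (ez m))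
  where
  mono-∂x : ∀ u e j l → monoCoeff (mono (ℕtoℚ e * u) (e ℕ.∸ 1) j l) ≋ ∂xᶜ (monoCoeff (mono u e j l))
  mono-∂x u zero    j l a b c = if-*-zeroˡ (matches 0 j l a b c) (ℕtoℚ (suc a)) u
  mono-∂x u (suc e) j l a b c =
    trans (if-matches e j l a b c (λ e _ _ → ℕtoℚ (suc e) * u)) (if-* _ (ℕtoℚ (suc a)) u)

coeff-∂z : ∀ f → coeff (∂z f) ≋ ∂zᶜ (coeff f)
coeff-∂z = coeff-map _ linear-∂zᶜ (λ m → mono-∂z (co m) (ex m) (ey m) (ez m))
  where
  mono-∂z : ∀ u e j l → monoCoeff (mono (ℕtoℚ l * u) e j (l ℕ.∸ 1)) ≋ ∂zᶜ (monoCoeff (mono u e j l))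
  mono-∂z u e j zero    a b c = trans (if-*-zeroˡ (matches e j 0 a b c) (ℕtoℚ (suc c)) u)
    (cong (λ t → ℕtoℚ (suc c) * (if t then u else 0ℚ))
          (sym (∧-zeroʳ³ (does (e ℕ.≟ a)) (does (j ℤ.≟ b)))))
  mono-∂z u e j (suc l) a b c =
    trans (if-matches e j l a b c (λ _ _ l → ℕtoℚ (suc l) * u)) (if-* _ (ℕtoℚ (suc c)) u)

coeff-∂y : ∀ f → coeff (∂y f) ≋ ∂yᶜ (coeff f)
coeff-∂y = coeff-map _ linear-∂yᶜ (λ m → mono-∂y (co m) (ex m) (ey m) (ez m))
  where
  mono-∂y : ∀ u e j l → monoCoeff (mono (ℤtoℚ j * u) e (j ℤ.- + 1) l) ≋ ∂yᶜ (monoCoeff (mono u e j l))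
  mono-∂y u e j l a b c = begin
    (if matches e (j ℤ.- + 1) l a b c then ℤtoℚ j * u else 0ℚ)
      ≡⟨ cong (λ t → if t then ℤtoℚ j * u else 0ℚ) (matches-cong-y e l a c (-≡⇔≡+ j b (+ 1))) ⟩
    (if matches e j l a (b ℤ.+ + 1) c then ℤtoℚ j * u else 0ℚ)
      ≡⟨ if-matches e j l a (b ℤ.+ + 1) c (λ _ j _ → ℤtoℚ j * u) ⟩
    (if matches e j l a (b ℤ.+ + 1) c then ℤtoℚ (b ℤ.+ + 1) * u else 0ℚ)
      ≡⟨ if-* _ (ℤtoℚ (b ℤ.+ + 1)) u ⟩
    ℤtoℚ (b ℤ.+ + 1) * (if matches e j l a (b ℤ.+ + 1) c then u else 0ℚ) ∎
    where open ≡-Reasoning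

monoCoeff-shift : ∀ u i e j f l g →
  monoCoeff (mono u (i ℕ.+ e) (j ℤ.+ f) (l ℕ.+ g)) ≋ shiftX i (shiftZ l (shiftY j (monoCoeff (mono u e f g))))
monoCoeff-shift u zero    e j f l g a       b c = shiftYZ l a b c
  where
  +≡⇔≡- : ∀ {b} → (j ℤ.+ f ≡ b) ⇔ (f ≡ b ℤ.- j)
  +≡⇔≡- {b} = mk⇔ (λ p → trans (sym (cancel j f)) (cong (ℤ._- j) p))
                  (λ p → trans (cong (λ t → j ℤ.+ t) p) (cancel′ j b))
    where
    cancel : ∀ j f → j ℤ.+ f ℤ.- j ≡ f
    cancel = ℤ-Solver.solve-∀
    cancel′ : ∀ j b → j ℤ.+ (b ℤ.- j) ≡ b
    cancel′ = ℤ-Solver.solve-∀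
  shiftYZ : ∀ l → monoCoeff (mono u e (j ℤ.+ f) (l ℕ.+ g)) ≋ shiftZ l (shiftY j (monoCoeff (mono u e f g)))
  shiftYZ zero    a b c       = cong (λ t → if t then u else 0ℚ) (matches-cong-y e g a c +≡⇔≡-)
  shiftYZ (suc l) a b zero    =
    cong (λ t → if t then u else 0ℚ) (∧-zeroʳ³ (does (e ℕ.≟ a)) (does (j ℤ.+ f ℤ.≟ b)))
  shiftYZ (suc l) a b (suc c) = shiftYZ l a b c
monoCoeff-shift u (suc i) e j f l g zero    b c = refl
monoCoeff-shift u (suc i) e j f l g (suc a) b c = monoCoeff-shift u i e j f l g a b c

coeff-⊗ : ∀ P g → coeff (P ⊗ g) ≋ polyᶜ P (coeff g)
coeff-⊗ []      g a b c = refl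
coeff-⊗ (m ∷ P) g a b c =
  trans (coeff-++ (map (monoMul m) g) (P ⊗ g) a b c)
        (cong₂ _+_ (coeff-map (monoMul m) (linear-monoᶜ m) mono-⊗ g a b c) (coeff-⊗ P g a b c))
  where
  mono-⊗ : ∀ n → monoCoeff (monoMul m n) ≋ monoᶜ m (monoCoeff n)
  mono-⊗ n a b c = trans (if-* _ (co m) (co n))
    (cong (co m *_) (monoCoeff-shift (co n) (ex m) (ex n) (ey m) (ey n) (ez m) (ez n) a b c))

der : Poly → Poly → Poly → Poly → Poly
der P Q R f = P ⊗ ∂x f ⊕ Q ⊗ ∂y f ⊕ R ⊗ ∂z f

coeff-der : ∀ P Q R f → coeff (der P Q R f) ≋ derᶜ P Q R (coeff f)
coeff-der P Q R f a b c =
  trans (coeff-++ (P ⊗ ∂x f ⊕ Q ⊗ ∂y f) (R ⊗ ∂z f) a b c)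
    (cong₂ _+_ (trans (coeff-++ (P ⊗ ∂x f) (Q ⊗ ∂y f) a b c)
                      (cong₂ _+_ (term P ∂x ∂xᶜ coeff-∂x) (term Q ∂y ∂yᶜ coeff-∂y)))
               (term R ∂z ∂zᶜ coeff-∂z))
  where
  term : ∀ S (∂ : Poly → Poly) (∂ᶜ : Op) → (∀ f → coeff (∂ f) ≋ ∂ᶜ (coeff f)) →
    coeff (S ⊗ ∂ f) a b c ≡ polyᶜ S (∂ᶜ (coeff f)) a b c
  term S ∂ ∂ᶜ coeff-∂ = trans (coeff-⊗ S (∂ f) a b c) (ext (linear-polyᶜ S) (coeff-∂ f) a b c)

deriv : (ℕ → ℚ) → ℕ → ℚ
deriv g a = ℕtoℚ (suc a) * g (suc a)

shift-deriv : ∀ i g a → shift i (deriv g) a ≡ (ℕtoℚ (suc a) - ℕtoℚ i) * shift i g (suc a)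
shift-deriv zero          g a       = minus-zero (ℕtoℚ (suc a)) (g (suc a))
  where
  minus-zero : ∀ x y → x * y ≡ (x - 0ℚ) * y
  minus-zero = solve-∀ ℚ-ring
shift-deriv (suc zero)    g zero    = sym (ℚP.*-zeroˡ (g 0))
shift-deriv (suc (suc i)) g zero    = sym (ℚP.*-zeroʳ (ℕtoℚ 1 - ℕtoℚ (suc (suc i))))
shift-deriv (suc i)       g (suc a) = begin
  shift i (deriv g) a
    ≡⟨ shift-deriv i g a ⟩
  (ℕtoℚ (suc a) - ℕtoℚ i) * shift i g (suc a)
    ≡⟨ cong (_* shift i g (suc a)) (suc-sub-suc (ℕtoℚ (suc a)) (ℕtoℚ i)) ⟨
  ((1ℚ + ℕtoℚ (suc a)) - (1ℚ + ℕtoℚ i)) * shift i g (suc a)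
    ≡⟨ cong₂ (λ s t → (s - t) * shift i g (suc a)) (ℕtoℚ-suc (suc a)) (ℕtoℚ-suc i) ⟨
  (ℕtoℚ (suc (suc a)) - ℕtoℚ (suc i)) * shift i g (suc a) ∎
  where
  open ≡-Reasoning
  suc-sub-suc : ∀ x y → (1ℚ + x) - (1ℚ + y) ≡ x - y
  suc-sub-suc = solve-∀ ℚ-ring

deriv-shift : ∀ i g a → deriv (shift i g) a ≡ ℕtoℚ i * shift (i ℕ.∸ 1) g a + shift i (deriv g) a
deriv-shift zero    g a = sym (trans (cong (_+ deriv g a) (ℚP.*-zeroˡ (g a))) (ℚP.+-identityˡ _))
deriv-shift (suc i) g a =
  trans (split (ℕtoℚ (suc a)) (ℕtoℚ (suc i)) (shift i g a))
        (cong (_+_ (ℕtoℚ (suc i) * shift i g a)) (sym (shift-deriv (suc i) g a)))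
  where
  split : ∀ x y z → x * z ≡ y * z + (x - y) * z
  split = solve-∀ ℚ-ring

∂xᶜ-shiftX : ∀ i F → ∂xᶜ (shiftX i F) ≋ ℕtoℚ i ⊡ shiftX (i ℕ.∸ 1) F ⊞ shiftX i (∂xᶜ F)
∂xᶜ-shiftX i F a b c = deriv-shift i (λ a → F a b c) a

∂xᶜ-shiftZ : ∀ l F → ∂xᶜ (shiftZ l F) ≋ shiftZ l (∂xᶜ F)
∂xᶜ-shiftZ l F a b c =
  sym (shift-zipWith (λ u _ → ℕtoℚ (suc a) * u) (ℚP.*-zeroʳ (ℕtoℚ (suc a)))
                     l (λ c → F (suc a) b c) (λ _ → 0ℚ) c)

∂xMono : Mono → Mono
∂xMono m = mono (ℕtoℚ (ex m) * co m) (ex m ℕ.∸ 1) (ey m) (ez m)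

∂xᶜ-monoᶜ : ∀ m H → ∂xᶜ (monoᶜ m H) ≋ monoᶜ (∂xMono m) H ⊞ monoᶜ m (∂xᶜ H)
∂xᶜ-monoᶜ m H a b c = begin
  ℕtoℚ (suc a) * (k * shiftX i S (suc a) b c)
    ≡⟨ *-left-comm (ℕtoℚ (suc a)) k _ ⟩
  k * (ℕtoℚ (suc a) * shiftX i S (suc a) b c)
    ≡⟨ cong (k *_) (∂xᶜ-shiftX i S a b c) ⟩
  k * (ℕtoℚ i * shiftX (i ℕ.∸ 1) S a b c + shiftX i (∂xᶜ S) a b c)
    ≡⟨ distrib k (ℕtoℚ i) _ _ ⟩
  (ℕtoℚ i * k) * shiftX (i ℕ.∸ 1) S a b c + k * shiftX i (∂xᶜ S) a b c
    ≡⟨ cong (λ t → (ℕtoℚ i * k) * shiftX (i ℕ.∸ 1) S a b c + k * t)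
            (ext (linear-shiftX i) (∂xᶜ-shiftZ (ez m) (shiftY (ey m) H)) a b c) ⟩
  (ℕtoℚ i * k) * shiftX (i ℕ.∸ 1) S a b c + k * shiftX i (shiftZ (ez m) (shiftY (ey m) (∂xᶜ H))) a b c ∎
  where
  open ≡-Reasoning
  k = co m
  i = ex m
  S = shiftZ (ez m) (shiftY (ey m) H)
  distrib : ∀ k n x y → k * (n * x + y) ≡ (n * k) * x + k * y
  distrib = solve-∀ ℚ-ring

∂xᶜ-polyᶜ : ∀ P H → ∂xᶜ (polyᶜ P H) ≋ polyᶜ (∂x P) H ⊞ polyᶜ P (∂xᶜ H)
∂xᶜ-polyᶜ []      H a b c = ℚP.*-zeroʳ (ℕtoℚ (suc a))
∂xᶜ-polyᶜ (m ∷ P) H a b c =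
  trans (⊞-homo linear-∂xᶜ (monoᶜ m H) (polyᶜ P H) a b c)
  (trans (cong₂ _+_ (∂xᶜ-monoᶜ m H a b c) (∂xᶜ-polyᶜ P H a b c))
         (+-interchange (monoᶜ (∂xMono m) H a b c) _ _ _))

∂xᶜ∂yᶜ-comm : ∀ G → ∂xᶜ (∂yᶜ G) ≋ ∂yᶜ (∂xᶜ G)
∂xᶜ∂yᶜ-comm G a b c = *-left-comm (ℕtoℚ (suc a)) (ℤtoℚ (b ℤ.+ + 1)) (G (suc a) (b ℤ.+ + 1) c)

∂xᶜ∂zᶜ-comm : ∀ G → ∂xᶜ (∂zᶜ G) ≋ ∂zᶜ (∂xᶜ G)
∂xᶜ∂zᶜ-comm G a b c = *-left-comm (ℕtoℚ (suc a)) (ℕtoℚ (suc c)) (G (suc a) b (suc c))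

∂xᶜ-derᶜ : ∀ P Q R F →
  ∂xᶜ (derᶜ P Q R F) ≋ derᶜ (∂x P) (∂x Q) (∂x R) F ⊞ derᶜ P Q R (∂xᶜ F)
∂xᶜ-derᶜ P Q R F a b c = begin
  ∂xᶜ (X ⊞ Y ⊞ Z) a b c
    ≡⟨ ⊞-homo linear-∂xᶜ (X ⊞ Y) Z a b c ⟩
  ∂xᶜ (X ⊞ Y) a b c + ∂xᶜ Z a b c
    ≡⟨ cong (_+ ∂xᶜ Z a b c) (⊞-homo linear-∂xᶜ X Y a b c) ⟩
  ∂xᶜ X a b c + ∂xᶜ Y a b c + ∂xᶜ Z a b c
    ≡⟨ cong₂ _+_ (cong₂ _+_ (leibniz P ∂xᶜ (λ G a b c → refl) a b c)
                            (leibniz Q ∂yᶜ ∂xᶜ∂yᶜ-comm a b c))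
                 (leibniz R ∂zᶜ ∂xᶜ∂zᶜ-comm a b c) ⟩
  (X′ a b c + X″ a b c) + (Y′ a b c + Y″ a b c) + (Z′ a b c + Z″ a b c)
    ≡⟨ cong (_+ (Z′ a b c + Z″ a b c)) (+-interchange (X′ a b c) _ _ _) ⟩
  (X′ a b c + Y′ a b c) + (X″ a b c + Y″ a b c) + (Z′ a b c + Z″ a b c)
    ≡⟨ +-interchange (X′ a b c + Y′ a b c) _ _ _ ⟩
  (X′ ⊞ Y′ ⊞ Z′) a b c + (X″ ⊞ Y″ ⊞ Z″) a b c ∎
  where
  open ≡-Reasoning
  X = polyᶜ P (∂xᶜ F)
  Y = polyᶜ Q (∂yᶜ F)
  Z = polyᶜ R (∂zᶜ F)
  X′ = polyᶜ (∂x P) (∂xᶜ F)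
  Y′ = polyᶜ (∂x Q) (∂yᶜ F)
  Z′ = polyᶜ (∂x R) (∂zᶜ F)
  X″ = polyᶜ P (∂xᶜ (∂xᶜ F))
  Y″ = polyᶜ Q (∂yᶜ (∂xᶜ F))
  Z″ = polyᶜ R (∂zᶜ (∂xᶜ F))
  leibniz : ∀ S (∂ᶜ : Op) → (∀ G → ∂xᶜ (∂ᶜ G) ≋ ∂ᶜ (∂xᶜ G)) →
    ∂xᶜ (polyᶜ S (∂ᶜ F)) ≋ polyᶜ (∂x S) (∂ᶜ F) ⊞ polyᶜ S (∂ᶜ (∂xᶜ F))
  leibniz S ∂ᶜ ∂xᶜ∂ᶜ a b c = trans (∂xᶜ-polyᶜ S (∂ᶜ F) a b c)
    (cong (_+_ (polyᶜ (∂x S) (∂ᶜ F) a b c)) (ext (linear-polyᶜ S) (∂xᶜ∂ᶜ F) a b c))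

∂x-der : ∀ P Q R f → ∂x (der P Q R f) ≈ der (∂x P) (∂x Q) (∂x R) f ⊕ der P Q R (∂x f)
∂x-der P Q R f a b c = begin
  coeff (∂x (der P Q R f)) a b c
    ≡⟨ coeff-∂x (der P Q R f) a b c ⟩
  ∂xᶜ (coeff (der P Q R f)) a b c
    ≡⟨ ext linear-∂xᶜ (coeff-der P Q R f) a b c ⟩
  ∂xᶜ (derᶜ P Q R (coeff f)) a b c
    ≡⟨ ∂xᶜ-derᶜ P Q R (coeff f) a b c ⟩
  derᶜ (∂x P) (∂x Q) (∂x R) (coeff f) a b c + derᶜ P Q R (∂xᶜ (coeff f)) a b c
    ≡⟨ cong₂ _+_ (coeff-der (∂x P) (∂x Q) (∂x R) f a b c)
                 (trans (coeff-der P Q R (∂x f) a b c) (ext (linear-derᶜ P Q R) (coeff-∂x f) a b c)) ⟨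
  coeff (der (∂x P) (∂x Q) (∂x R) f) a b c + coeff (der P Q R (∂x f)) a b c
    ≡⟨ coeff-++ (der (∂x P) (∂x Q) (∂x R) f) (der P Q R (∂x f)) a b c ⟨
  coeff (der (∂x P) (∂x Q) (∂x R) f ⊕ der P Q R (∂x f)) a b c ∎
  where open ≡-Reasoning

weight : ℕ → ℤ → ℕ → ℚ
weight a b c = ℕtoℚ 2 * ℕtoℚ a + ℕtoℚ 4 * ℤtoℚ b + ℕtoℚ 6 * ℕtoℚ c

euler : Op
euler F a b c = weight a b c * F a b c

record IsHomogeneous (δ : ℚ) (O : Op) : Set where
  constructor homogeneous
  field euler-comm : ∀ F → euler (O F) ≋ O (euler F) ⊞ δ ⊡ O F
open IsHomogeneous

*-split : ∀ {w w′} α x → w ≡ α + w′ → w * x ≡ w′ * x + α * x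
*-split {w′ = w′} α x refl = split α w′ x
  where
  split : ∀ α w′ x → (α + w′) * x ≡ w′ * x + α * x
  split = solve-∀ ℚ-ring

homogeneous-∘ : ∀ {O O′ δ ε} → IsLinear O → IsHomogeneous δ O → IsHomogeneous ε O′ →
  IsHomogeneous (δ + ε) (λ F → O (O′ F))
homogeneous-∘ {O} {O′} {δ} {ε} L hO hO′ = homogeneous λ F a b c → begin
  euler (O (O′ F)) a b c
    ≡⟨ euler-comm hO (O′ F) a b c ⟩
  O (euler (O′ F)) a b c + δ * O (O′ F) a b c
    ≡⟨ cong (_+ δ * O (O′ F) a b c) (ext L (euler-comm hO′ F) a b c) ⟩
  O (O′ (euler F) ⊞ ε ⊡ O′ F) a b c + δ * O (O′ F) a b c
    ≡⟨ cong (_+ δ * O (O′ F) a b c) (trans (⊞-homo L (O′ (euler F)) (ε ⊡ O′ F) a b c)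
                                           (cong (_+_ (O (O′ (euler F)) a b c)) (⊡-homo L ε (O′ F) a b c))) ⟩
  O (O′ (euler F)) a b c + ε * O (O′ F) a b c + δ * O (O′ F) a b c
    ≡⟨ collect (O (O′ (euler F)) a b c) (O (O′ F) a b c) δ ε ⟩
  O (O′ (euler F)) a b c + (δ + ε) * O (O′ F) a b c ∎
  where
  open ≡-Reasoning
  collect : ∀ y x δ ε → y + ε * x + δ * x ≡ y + (δ + ε) * x
  collect = solve-∀ ℚ-ring

homogeneous-⊞ : ∀ {O O′ δ} → IsHomogeneous δ O → IsHomogeneous δ O′ →
  IsHomogeneous δ (λ F → O F ⊞ O′ F)
homogeneous-⊞ {O} {O′} {δ} hO hO′ = homogeneous λ F a b c →
  trans (*-distribˡ-+ (weight a b c) (O F a b c) (O′ F a b c))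
  (trans (cong₂ _+_ (euler-comm hO F a b c) (euler-comm hO′ F a b c))
         (collect (O (euler F) a b c) (O′ (euler F) a b c) (O F a b c) (O′ F a b c) δ))
  where
  collect : ∀ y y′ x x′ δ → (y + δ * x) + (y′ + δ * x′) ≡ (y + y′) + δ * (x + x′)
  collect = solve-∀ ℚ-ring

homogeneous-𝟘 : ∀ {δ} → IsHomogeneous δ (λ _ → 𝟘)
homogeneous-𝟘 {δ} = homogeneous λ F a b c → zeros (weight a b c) δ
  where
  zeros : ∀ w δ → w * 0ℚ ≡ 0ℚ + δ * 0ℚ
  zeros = solve-∀ ℚ-ring

homogeneous-⊡ : ∀ k → IsHomogeneous 0ℚ (k ⊡_)
homogeneous-⊡ k = homogeneous λ F a b c → comm (weight a b c) k (F a b c)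
  where
  comm : ∀ w k x → w * (k * x) ≡ k * (w * x) + 0ℚ * (k * x)
  comm = solve-∀ ℚ-ring

homogeneous-weighted : ∀ (w : Coeffs) (σx : ℕ → ℕ) (σy : ℤ → ℤ) (σz : ℕ → ℕ) α →
  (∀ a b c → weight (σx a) (σy b) (σz c) ≡ α + weight a b c) →
  IsHomogeneous (- α) (λ F a b c → w a b c * F (σx a) (σy b) (σz c))
homogeneous-weighted w σx σy σz α hσ = homogeneous λ F a b c →
  let x = F (σx a) (σy b) (σz c) in
  trans (lower (weight a b c) α (w a b c) x)
        (cong (λ t → w a b c * (t * x) + (- α) * (w a b c * x)) (sym (hσ a b c)))
  where
  lower : ∀ W α s x → W * (s * x) ≡ s * ((α + W) * x) + (- α) * (s * x)
  lower = solve-∀ ℚ-ring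

weight-sucˣ : ∀ a b c → weight (suc a) b c ≡ ℕtoℚ 2 + weight a b c
weight-sucˣ a b c = trans (cong (λ t → ℕtoℚ 2 * t + ℕtoℚ 4 * ℤtoℚ b + ℕtoℚ 6 * ℕtoℚ c) (ℕtoℚ-suc a))
                          (step (ℕtoℚ 2) (ℕtoℚ a) (ℕtoℚ 4 * ℤtoℚ b) (ℕtoℚ 6 * ℕtoℚ c))
  where
  step : ∀ t A B C → t * (1ℚ + A) + B + C ≡ t + (t * A + B + C)
  step = solve-∀ ℚ-ring

weight-sucʸ : ∀ a b c → weight a (b ℤ.+ + 1) c ≡ ℕtoℚ 4 + weight a b c
weight-sucʸ a b c = trans (cong (λ t → ℕtoℚ 2 * ℕtoℚ a + ℕtoℚ 4 * t + ℕtoℚ 6 * ℕtoℚ c) (ℤtoℚ-+ b (+ 1)))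
                          (step (ℕtoℚ 4) (ℕtoℚ 2 * ℕtoℚ a) (ℤtoℚ b) (ℕtoℚ 6 * ℕtoℚ c))
  where
  step : ∀ t A B C → A + t * (B + 1ℚ) + C ≡ t + (A + t * B + C)
  step = solve-∀ ℚ-ring

weight-sucᶻ : ∀ a b c → weight a b (suc c) ≡ ℕtoℚ 6 + weight a b c
weight-sucᶻ a b c = trans (cong (λ t → ℕtoℚ 2 * ℕtoℚ a + ℕtoℚ 4 * ℤtoℚ b + ℕtoℚ 6 * t) (ℕtoℚ-suc c))
                          (step (ℕtoℚ 6) (ℕtoℚ 2 * ℕtoℚ a + ℕtoℚ 4 * ℤtoℚ b) (ℕtoℚ c))
  where
  step : ∀ t A C → A + t * (1ℚ + C) ≡ t + (A + t * C)
  step = solve-∀ ℚ-ring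

weight-subʸ : ∀ a b c j → weight a b c ≡ ℕtoℚ 4 * ℤtoℚ j + weight a (b ℤ.- j) c
weight-subʸ a b c j =
  trans (cong (λ t → ℕtoℚ 2 * ℕtoℚ a + ℕtoℚ 4 * t + ℕtoℚ 6 * ℕtoℚ c)
              (trans (cong ℤtoℚ (sym (-+-cancel b j))) (ℤtoℚ-+ (b ℤ.- j) j)))
        (step (ℕtoℚ 4) (ℕtoℚ 2 * ℕtoℚ a) (ℤtoℚ (b ℤ.- j)) (ℤtoℚ j) (ℕtoℚ 6 * ℕtoℚ c))
  where
  -+-cancel : ∀ b j → b ℤ.- j ℤ.+ j ≡ b
  -+-cancel = ℤ-Solver.solve-∀
  step : ∀ t A B J C → A + t * (B + J) + C ≡ t * J + (A + t * B + C)
  step = solve-∀ ℚ-ring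

homogeneous-∂xᶜ : IsHomogeneous (- ℕtoℚ 2) ∂xᶜ
homogeneous-∂xᶜ =
  homogeneous-weighted (λ a b c → ℕtoℚ (suc a)) suc (λ b → b) (λ c → c) (ℕtoℚ 2) weight-sucˣ

homogeneous-∂yᶜ : IsHomogeneous (- ℕtoℚ 4) ∂yᶜ
homogeneous-∂yᶜ =
  homogeneous-weighted (λ a b c → ℤtoℚ (b ℤ.+ + 1)) (λ a → a) (ℤ._+ + 1) (λ c → c) (ℕtoℚ 4) weight-sucʸ

homogeneous-∂zᶜ : IsHomogeneous (- ℕtoℚ 6) ∂zᶜ
homogeneous-∂zᶜ =
  homogeneous-weighted (λ a b c → ℕtoℚ (suc c)) (λ a → a) (λ b → b) suc (ℕtoℚ 6) weight-sucᶻ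

shift-affine : ∀ (w : ℕ → ℚ) α → (∀ a → w (suc a) ≡ α + w a) → ∀ i g a →
  w a * shift i g a ≡ shift i (λ a → w a * g a) a + (α * ℕtoℚ i) * shift i g a
shift-affine w α hw zero    g a       = no-shift (w a) α (g a)
  where
  no-shift : ∀ w α x → w * x ≡ w * x + (α * 0ℚ) * x
  no-shift = solve-∀ ℚ-ring
shift-affine w α hw (suc i) g zero    = zeros (w 0) (α * ℕtoℚ (suc i))
  where
  zeros : ∀ w δ → w * 0ℚ ≡ 0ℚ + δ * 0ℚ
  zeros = solve-∀ ℚ-ring
shift-affine w α hw (suc i) g (suc a) = begin
  w (suc a) * X                     ≡⟨ *-split α X (hw a) ⟩
  w a * X + α * X                   ≡⟨ cong (_+ α * X) (shift-affine w α hw i g a) ⟩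
  S + (α * ℕtoℚ i) * X + α * X      ≡⟨ collect S X α (ℕtoℚ i) ⟩
  S + (α * (1ℚ + ℕtoℚ i)) * X       ≡⟨ cong (λ t → S + (α * t) * X) (ℕtoℚ-suc i) ⟨
  S + (α * ℕtoℚ (suc i)) * X        ∎
  where
  open ≡-Reasoning
  X = shift i g a
  S = shift i (λ a → w a * g a) a
  collect : ∀ S X α n → S + (α * n) * X + α * X ≡ S + (α * (1ℚ + n)) * X
  collect = solve-∀ ℚ-ring

homogeneous-shiftX : ∀ i → IsHomogeneous (ℕtoℚ 2 * ℕtoℚ i) (shiftX i)
homogeneous-shiftX i = homogeneous λ F a b c →
  shift-affine (λ a → weight a b c) (ℕtoℚ 2) (λ a → weight-sucˣ a b c) i (λ a → F a b c) a

homogeneous-shiftZ : ∀ l → IsHomogeneous (ℕtoℚ 6 * ℕtoℚ l) (shiftZ l)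
homogeneous-shiftZ l = homogeneous λ F a b c →
  shift-affine (λ c → weight a b c) (ℕtoℚ 6) (weight-sucᶻ a b) l (λ c → F a b c) c

homogeneous-shiftY : ∀ j → IsHomogeneous (ℕtoℚ 4 * ℤtoℚ j) (shiftY j)
homogeneous-shiftY j = homogeneous λ F a b c →
  *-split (ℕtoℚ 4 * ℤtoℚ j) (F a (b ℤ.- j) c) (weight-subʸ a b c j)

homogeneous-monoᶜ : ∀ m → IsHomogeneous (weight (ex m) (ey m) (ez m)) (monoᶜ m)
homogeneous-monoᶜ (mono k i j l) = subst (λ δ → IsHomogeneous δ (monoᶜ (mono k i j l)))
  (degree (ℕtoℚ 2 * ℕtoℚ i) (ℕtoℚ 4 * ℤtoℚ j) (ℕtoℚ 6 * ℕtoℚ l))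
  (homogeneous-∘ (linear-⊡ k) (homogeneous-⊡ k)
    (homogeneous-∘ (linear-shiftX i) (homogeneous-shiftX i)
      (homogeneous-∘ (linear-shiftZ l) (homogeneous-shiftZ l) (homogeneous-shiftY j))))
  where
  degree : ∀ x y z → 0ℚ + (x + (z + y)) ≡ x + y + z
  degree = solve-∀ ℚ-ring

homogeneous-polyᶜ : ∀ {w} P → All (λ m → weight (ex m) (ey m) (ez m) ≡ w) P → IsHomogeneous w (polyᶜ P)
homogeneous-polyᶜ []      []         = homogeneous-𝟘
homogeneous-polyᶜ (m ∷ P) (refl ∷ hP) = homogeneous-⊞ (homogeneous-monoᶜ m) (homogeneous-polyᶜ P hP)

homogeneous-derᶜ : ∀ P Q R →
  All (λ m → weight (ex m) (ey m) (ez m) ≡ ℕtoℚ 4) P →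
  All (λ m → weight (ex m) (ey m) (ez m) ≡ ℕtoℚ 6) Q →
  All (λ m → weight (ex m) (ey m) (ez m) ≡ ℕtoℚ 8) R →
  IsHomogeneous (ℕtoℚ 2) (derᶜ P Q R)
homogeneous-derᶜ P Q R hP hQ hR =
  homogeneous-⊞ (homogeneous-⊞ (homogeneous-∘ (linear-polyᶜ P) (homogeneous-polyᶜ P hP) homogeneous-∂xᶜ)
                               (homogeneous-∘ (linear-polyᶜ Q) (homogeneous-polyᶜ Q hQ) homogeneous-∂yᶜ))
                (homogeneous-∘ (linear-polyᶜ R) (homogeneous-polyᶜ R hR) homogeneous-∂zᶜ)

iterᶜ : ℕ → Op → Op
iterᶜ zero    O F = F
iterᶜ (suc n) O F = O (iterᶜ n O F)

linear-iterᶜ : ∀ {O} n → IsLinear O → IsLinear (iterᶜ n O)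
linear-iterᶜ zero    L = record
  { ext    = λ e → e
  ; ⊞-homo = λ F G a b c → refl
  ; ⊡-homo = λ k F a b c → refl
  ; 𝟘-homo = λ a b c → refl
  }
linear-iterᶜ (suc n) L = linear-∘ L (linear-iterᶜ n L)

homogeneous-iterᶜ : ∀ {O δ} n → IsLinear O → IsHomogeneous δ O →
  IsHomogeneous (ℕtoℚ n * δ) (iterᶜ n O)
homogeneous-iterᶜ {δ = δ} zero    L hO = homogeneous λ F a b c → no-shift (weight a b c) δ (F a b c)
  where
  no-shift : ∀ w δ x → w * x ≡ w * x + (0ℚ * δ) * x
  no-shift = solve-∀ ℚ-ring
homogeneous-iterᶜ {O} {δ} (suc n) L hO = subst (λ ε → IsHomogeneous ε (iterᶜ (suc n) O))
  (trans (sym (succ δ (ℕtoℚ n))) (cong (_* δ) (sym (ℕtoℚ-suc n))))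
  (homogeneous-∘ L hO (homogeneous-iterᶜ n L hO))
  where
  succ : ∀ δ n → (1ℚ + n) * δ ≡ δ + n * δ
  succ = solve-∀ ℚ-ring

polyᶜ-zero : ∀ P → All (λ m → co m ≡ 0ℚ) P → ∀ H → polyᶜ P H ≋ 𝟘
polyᶜ-zero []      []          H a b c = refl
polyᶜ-zero (m ∷ P) (k≡0 ∷ hP) H a b c =
  cong₂ _+_ (trans (cong (_* x) k≡0) (ℚP.*-zeroˡ x)) (polyᶜ-zero P hP H a b c)
  where
  x = shiftX (ex m) (shiftZ (ez m) (shiftY (ey m) H)) a b c

x∂xᶜ : ∀ k H → monoᶜ (mono k 1 (+ 0) 0) (∂xᶜ H) ≋ λ a b c → k * (ℕtoℚ a * H a b c)
x∂xᶜ k H zero    b c = cong (k *_) (sym (ℚP.*-zeroˡ (H 0 b c)))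
x∂xᶜ k H (suc a) b c = cong (λ t → k * (ℕtoℚ (suc a) * H (suc a) t c)) (ℤP.+-identityʳ b)

y∂yᶜ : ∀ k H → monoᶜ (mono k 0 (+ 1) 0) (∂yᶜ H) ≋ λ a b c → k * (ℤtoℚ b * H a b c)
y∂yᶜ k H a b c = cong (λ t → k * (ℤtoℚ t * H a t c)) (-+-cancel b)
  where
  -+-cancel : ∀ b → b ℤ.- + 1 ℤ.+ + 1 ≡ b
  -+-cancel = ℤ-Solver.solve-∀

z∂zᶜ : ∀ k H → monoᶜ (mono k 0 (+ 0) 1) (∂zᶜ H) ≋ λ a b c → k * (ℕtoℚ c * H a b c)
z∂zᶜ k H a b zero    = cong (k *_) (sym (ℚP.*-zeroˡ (H a b 0)))
z∂zᶜ k H a b (suc c) = cong (λ t → k * (ℕtoℚ (suc c) * H a t (suc c))) (ℤP.+-identityʳ b)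

-- ∂x of a monomial free of x is kept as a monomial with coefficient 0, whence the tails zP, zQ, zR.
derᶜ-euler : ∀ s zP zQ zR →
  All (λ m → co m ≡ 0ℚ) zP → All (λ m → co m ≡ 0ℚ) zQ → All (λ m → co m ≡ 0ℚ) zR → ∀ F →
  derᶜ (mono (ℕtoℚ 2 * s) 1 (+ 0) 0 ∷ zP)
       (mono (ℕtoℚ 4 * s) 0 (+ 1) 0 ∷ zQ)
       (mono (ℕtoℚ 6 * s) 0 (+ 0) 1 ∷ zR) F ≋ s ⊡ euler F
derᶜ-euler s zP zQ zR hP hQ hR F a b c =
  trans (cong₂ _+_ (cong₂ _+_ (cong₂ _+_ (x∂xᶜ (ℕtoℚ 2 * s) F a b c) (polyᶜ-zero zP hP (∂xᶜ F) a b c))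
                              (cong₂ _+_ (y∂yᶜ (ℕtoℚ 4 * s) F a b c) (polyᶜ-zero zQ hQ (∂yᶜ F) a b c)))
                   (cong₂ _+_ (z∂zᶜ (ℕtoℚ 6 * s) F a b c) (polyᶜ-zero zR hR (∂zᶜ F) a b c)))
        (collect s (ℕtoℚ 2) (ℕtoℚ 4) (ℕtoℚ 6) (ℕtoℚ a) (ℤtoℚ b) (ℕtoℚ c) (F a b c))
  where
  collect : ∀ s t₂ t₄ t₆ A B C X →
    (t₂ * s * (A * X) + 0ℚ) + (t₄ * s * (B * X) + 0ℚ) + (t₆ * s * (C * X) + 0ℚ)
      ≡ s * ((t₂ * A + t₄ * B + t₆ * C) * X)
  collect = solve-∀ ℚ-ring

euler-iterᶜ : ∀ {O δ} → IsLinear O → IsHomogeneous δ O → ∀ s n F →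
  s ⊡ euler (iterᶜ n O F) ≋ iterᶜ n O (s ⊡ euler F) ⊞ (s * (ℕtoℚ n * δ)) ⊡ iterᶜ n O F
euler-iterᶜ {O} {δ} L hO s n F a b c =
  trans (cong (s *_) (euler-comm (homogeneous-iterᶜ n L hO) F a b c))
  (trans (*-distribˡ-+ s _ _)
         (cong₂ _+_ (sym (⊡-homo (linear-iterᶜ n L) s (euler F) a b c)) (sym (ℚP.*-assoc s _ _))))

coeff-iter : ∀ P Q R n f → coeff (iter n (der P Q R) f) ≋ iterᶜ n (derᶜ P Q R) (coeff f)
coeff-iter P Q R zero    f a b c = refl
coeff-iter P Q R (suc n) f a b c =
  trans (coeff-der P Q R (iter n (der P Q R) f) a b c) (ext (linear-derᶜ P Q R) (coeff-iter P Q R n f) a b c)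

der-iter : ∀ P Q R s δ → (∀ F → derᶜ (∂x P) (∂x Q) (∂x R) F ≋ s ⊡ euler F) →
  IsHomogeneous δ (derᶜ P Q R) → ∀ n f →
  der (∂x P) (∂x Q) (∂x R) (iter n (der P Q R) f)
    ≈ iter n (der P Q R) (der (∂x P) (∂x Q) (∂x R) f) ⊕ (s * (ℕtoℚ n * δ)) · iter n (der P Q R) f
der-iter P Q R s δ euler-form hD n f a b c = begin
  coeff (der P′ Q′ R′ Dⁿf) a b c
    ≡⟨ trans (coeff-der P′ Q′ R′ Dⁿf a b c) (ext (linear-derᶜ P′ Q′ R′) (coeff-iter P Q R n f) a b c) ⟩
  derᶜ P′ Q′ R′ (iterᶜ n Dᶜ F) a b c
    ≡⟨ euler-form (iterᶜ n Dᶜ F) a b c ⟩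
  s * euler (iterᶜ n Dᶜ F) a b c
    ≡⟨ euler-iterᶜ (linear-derᶜ P Q R) hD s n F a b c ⟩
  iterᶜ n Dᶜ (s ⊡ euler F) a b c + c′ * iterᶜ n Dᶜ F a b c
    ≡⟨ cong₂ _+_ (ext (linear-iterᶜ n (linear-derᶜ P Q R)) (λ a b c → sym (euler-form F a b c)) a b c)
                 (cong (c′ *_) (sym (coeff-iter P Q R n f a b c))) ⟩
  iterᶜ n Dᶜ (derᶜ P′ Q′ R′ F) a b c + c′ * coeff Dⁿf a b c
    ≡⟨ cong₂ _+_ (trans (coeff-iter P Q R n (der P′ Q′ R′ f) a b c)
                        (ext (linear-iterᶜ n (linear-derᶜ P Q R)) (coeff-der P′ Q′ R′ f) a b c))
                 (coeff-· c′ Dⁿf a b c) ⟨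
  coeff (iter n (der P Q R) (der P′ Q′ R′ f)) a b c + coeff (c′ · Dⁿf) a b c
    ≡⟨ coeff-++ (iter n (der P Q R) (der P′ Q′ R′ f)) (c′ · Dⁿf) a b c ⟨
  coeff (iter n (der P Q R) (der P′ Q′ R′ f) ⊕ c′ · Dⁿf) a b c ∎
  where
  open ≡-Reasoning
  P′ = ∂x P
  Q′ = ∂x Q
  R′ = ∂x R
  Dᶜ = derᶜ P Q R
  F = coeff f
  Dⁿf = iter n (der P Q R) f
  c′ = s * (ℕtoℚ n * δ)

D̃-iter-D : ∀ N k →
  (∀ F → derᶜ (∂x (pP N)) (∂x (qP N)) (∂x (rP N)) F ≋ ℚ.fromℚᵘ (mkℚᵘ (+ 1) k) ⊡ euler F) →
  IsHomogeneous (ℕtoℚ 2) (derᶜ (pP N) (qP N) (rP N)) → ∀ n f →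
  D̃ N (iter n (D N) f) ≈ iter n (D N) (D̃ N f) ⊕ ℚ.fromℚᵘ (mkℚᵘ (+ (2 ℕ.* n)) k) · iter n (D N) f
D̃-iter-D N k euler-form homogeneous-D n f =
  subst (λ t → D̃ N (iter n (D N) f) ≈ iter n (D N) (D̃ N f) ⊕ t · iter n (D N) f)
        (1/suc-*-n*2 k n)
        (der-iter (pP N) (qP N) (rP N) (ℚ.fromℚᵘ (mkℚᵘ (+ 1) k)) (ℕtoℚ 2) euler-form homogeneous-D n f)

D̃-iter : ∀ N → (N ≡ 1 ⊎ N ≡ 2 ⊎ N ≡ 3) → ∀ n f →
  D̃ N (iter n (D N) f) ≈ iter n (D N) (D̃ N f) ⊕ (+ (2 ℕ.* n) / d N) · iter n (D N) f
D̃-iter .1 (inj₁ refl) = D̃-iter-D 1 11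
  (derᶜ-euler (ℚ.fromℚᵘ (mkℚᵘ (+ 1) 11)) (drop 1 (∂x (pP 1))) (drop 1 (∂x (qP 1))) (drop 1 (∂x (rP 1)))
              (refl ∷ []) (refl ∷ []) (refl ∷ []))
  (homogeneous-derᶜ (pP 1) (qP 1) (rP 1) (refl ∷ refl ∷ []) (refl ∷ refl ∷ []) (refl ∷ refl ∷ []))
D̃-iter .2 (inj₂ (inj₁ refl)) = D̃-iter-D 2 7
  (derᶜ-euler (ℚ.fromℚᵘ (mkℚᵘ (+ 1) 7)) (drop 1 (∂x (pP 2))) (drop 1 (∂x (qP 2))) (drop 1 (∂x (rP 2)))
              (refl ∷ []) (refl ∷ []) (refl ∷ refl ∷ []))
  (homogeneous-derᶜ (pP 2) (qP 2) (rP 2) (refl ∷ refl ∷ []) (refl ∷ refl ∷ []) (refl ∷ refl ∷ refl ∷ []))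
D̃-iter .3 (inj₂ (inj₂ refl)) = D̃-iter-D 3 5
  (derᶜ-euler (ℚ.fromℚᵘ (mkℚᵘ (+ 1) 5)) (drop 1 (∂x (pP 3))) (drop 1 (∂x (qP 3))) (drop 1 (∂x (rP 3)))
              (refl ∷ []) (refl ∷ []) (refl ∷ refl ∷ []))
  (homogeneous-derᶜ (pP 3) (qP 3) (rP 3) (refl ∷ refl ∷ []) (refl ∷ refl ∷ []) (refl ∷ refl ∷ refl ∷ []))

lemma4p5 : (N : ℕ) → (N ≡ 1 ⊎ N ≡ 2 ⊎ N ≡ 3) →
    ((f : Poly) → ∂x (D N f) ≈ D̃ N f ⊕ D N (∂x f))
    × ((n : ℕ) → n ℕ.≥ 1 → (f : Poly) →
        D̃ N (iter n (D N) f)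
          ≈ iter n (D N) (D̃ N f) ⊕ (+ (2 ℕ.* n) / d N) · iter n (D N) f)
lemma4p5 N N∈123 = ∂x-der (pP N) (qP N) (rP N) , λ n _ → D̃-iter N N∈123 n
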